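{- Let $\Omega_1$ and $\Omega_2$ be disjoint finite sets, let $A$ be a transitive permutation group on $\Omega_1$ and $B$ a transitive permutation group on $\Omega_2$. Let $N_A \trianglelefteq A$ and $N_B \trianglelefteq B$ be normal subgroups, and let $\phi \colon A/N_A \to B/N_B$ be a group isomorphism. Define \[ C=\{(a,b)\in A\times B : \phi(aN_A)=bN_B\}, \] viewed as a permutation group on $\Omega_1 \sqcup \Omega_2$ via $(a,b)\cdot x = a(x)$ for $x\in\Omega_1$ and $(a,b)\cdot x = b(x)$ for $x \in \Omega_2$. Suppose $N_A$ is not an essential kernel in $A$, i.e. there exists a proper subgroup $M<A$ that is transitive on $\Omega_1$ and satisfies $N_A M = A$. Then $C$ is not minimal as a two-orbit permutation group on $\Omega_1\sqcup\Omega_2$; that is, $C$ has a proper subgroup that is transitive on both $\Omega_1$ and $\Omega_2$.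
   Context: A normal subgroup $N_A \trianglelefteq A$ of a transitive permutation group $A$ on $\Omega_1$ is called an essential kernel in $A$ if there is no proper transitive subgroup $M<A$ (transitive on $\Omega_1$) with $N_A M = A$. A two-orbit permutation group $P$ acting on $\Omega=\Omega_1\sqcup\Omega_2$ (i.e. with orbits $\Omega_1$ and $\Omega_2$) is called minimal if it has no proper subgroup that is transitive on both $\Omega_1$ and $\Omega_2$. -}

module Defs where

open import Data.Nat using (ℕ)
open import Data.Fin using (Fin)
open import Data.Product using (Σ; ∃; _×_; _,_)
open import Relation.Nullary using (¬_)
open import Relation.Binary.PropositionalEquality using (_≡_)
open import Data.Fin.Permutation public
  using (Permutation′; _⟨$⟩ʳ_; _≈_; id; flip; _∘ₚ_)

-- Permutations of Ω = Fin n.  Group product in the usual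
-- (function-composition) convention: (π · ρ)(x) = π (ρ x).
Perm : ℕ → Set
Perm n = Permutation′ n

infixl 7 _·_
_·_ : ∀ {n} → Perm n → Perm n → Perm n
π · ρ = ρ ∘ₚ π

_⁻¹ : ∀ {n} → Perm n → Perm n
π ⁻¹ = flip π

PSet : ℕ → Set₁
PSet n = Perm n → Set

_⊆_ : ∀ {n} → PSet n → PSet n → Set
S ⊆ T = ∀ π → S π → T π

record IsPermGroup {n : ℕ} (G : PSet n) : Set where
  field
    resp  : ∀ π ρ → π ≈ ρ → G π → G ρ
    hasId : G id
    mul   : ∀ π ρ → G π → G ρ → G (π · ρ)
    inv   : ∀ π → G π → G (π ⁻¹)

IsTransitive : ∀ {n} → PSet n → Set
IsTransitive {n} G = ∀ (x y : Fin n) → Σ (Perm n) λ g → G g × (g ⟨$⟩ʳ x ≡ y)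

IsSubgroup : ∀ {n} → PSet n → PSet n → Set
IsSubgroup H G = IsPermGroup H × H ⊆ G

IsProperSubgroup : ∀ {n} → PSet n → PSet n → Set
IsProperSubgroup {n} H G =
  IsSubgroup H G × Σ (Perm n) λ g → G g × ¬ H g

IsNormalSubgroup : ∀ {n} → PSet n → PSet n → Set
IsNormalSubgroup N G =
  IsSubgroup N G × (∀ g x → G g → N x → N (g · x · g ⁻¹))

ProductCovers : ∀ {n} → PSet n → PSet n → PSet n → Set
ProductCovers {n} N M A =
  ∀ a → A a → Σ (Perm n) λ x → Σ (Perm n) λ y → N x × M y × (a ≈ x · y)

NotEssentialKernel : ∀ {n} → PSet n → PSet n → Set₁
NotEssentialKernel {n} N A =
  Σ (PSet n) λ M → IsProperSubgroup M A × IsTransitive M × ProductCovers N M A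

-- An isomorphism φ : A/N_A → B/N_B, presented (since Agda has no quotient
-- types) by a lift f : Sym(Ω₁) → Sym(Ω₂) with φ(a N_A) = f(a) N_B, subject to:
-- f maps A into B; well-defined on cosets; homomorphism modulo N_B;
-- injective on A/N_A; surjective onto B/N_B.
record IsQuotientIso {n m : ℕ} (A NA : PSet n) (B NB : PSet m)
                     (f : Perm n → Perm m) : Set where
  field
    into       : ∀ a → A a → B (f a)
    wellDef    : ∀ a a′ → A a → A a′ → NA (a ⁻¹ · a′) → NB (f a ⁻¹ · f a′)
    hom        : ∀ a a′ → A a → A a′ → NB ((f (a · a′)) ⁻¹ · (f a · f a′))
    injective  : ∀ a a′ → A a → A a′ → NB (f a ⁻¹ · f a′) → NA (a ⁻¹ · a′)
    surjective : ∀ b → B b → Σ (Perm n) λ a → A a × NB (f a ⁻¹ · b)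

-- Permutations of Ω₁ ⊔ Ω₂ preserving both parts are pairs (a , b) acting by
-- (a,b)·x = a x on Ω₁ and b x on Ω₂; this action is faithful, so we identify
-- such permutation groups with sets of pairs.
PairSet : ℕ → ℕ → Set₁
PairSet n m = Perm n × Perm m → Set

fibreProduct : ∀ {n m} → PSet n → PSet m → PSet m →
               (Perm n → Perm m) → PairSet n m
fibreProduct A B NB f (a , b) = A a × B b × NB (f a ⁻¹ · b)

record IsPairGroup {n m : ℕ} (D : PairSet n m) : Set where
  field
    resp  : ∀ a b a′ b′ → a ≈ a′ → b ≈ b′ → D (a , b) → D (a′ , b′)
    hasId : D (id , id)
    mul   : ∀ a b a′ b′ → D (a , b) → D (a′ , b′) → D (a · a′ , b · b′)
    inv   : ∀ a b → D (a , b) → D (a ⁻¹ , b ⁻¹)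

IsProperPairSubgroup : ∀ {n m} → PairSet n m → PairSet n m → Set
IsProperPairSubgroup {n} {m} D C =
  IsPairGroup D × (∀ p → D p → C p) × Σ (Perm n × Perm m) λ p → C p × ¬ D p

IsTwoOrbitTransitive : ∀ {n m} → PairSet n m → Set
IsTwoOrbitTransitive {n} {m} D =
  (∀ (x y : Fin n) → Σ (Perm n × Perm m) λ { (a , b) → D (a , b) × a ⟨$⟩ʳ x ≡ y }) ×
  (∀ (x y : Fin m) → Σ (Perm n × Perm m) λ { (a , b) → D (a , b) × b ⟨$⟩ʳ x ≡ y })

NotMinimal : ∀ {n m} → PairSet n m → Set₁
NotMinimal {n} {m} C =
  Σ (PairSet n m) λ D → IsProperPairSubgroup D C × IsTwoOrbitTransitive D

-- C restricted to a witness M of non-essentiality, D = {(a , b) ∈ C : a ∈ M}, is the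
-- required subgroup.  It is proper because M is, and transitive on Ω₁ because M is.
-- On Ω₂: any b ∈ B is φ(a N_A) for some a ∈ A, and writing a = u v with u ∈ N_A,
-- v ∈ M gives a N_A = v N_A, so (v , b) ∈ D; hence D projects onto B, which is
-- transitive.
module Submission where

open import Defs
open import Data.Nat using (ℕ)
open import Data.Product using (Σ; _×_; _,_; proj₁; proj₂)
open import Relation.Binary.PropositionalEquality using (_≡_; refl; sym; trans; cong)
open import Data.Fin.Permutation using (inverseˡ; inverseʳ; _⟨$⟩ˡ_)
import Relation.Binary.Reasoning.Base.Single as SingleRelReasoning

≈⇒id≈⁻¹· : ∀ {n} {x y : Perm n} → x ≈ y → id ≈ x ⁻¹ · y
≈⇒id≈⁻¹· {x = x} x≈y i = sym (trans (cong (x ⟨$⟩ˡ_) (sym (x≈y i))) (inverseˡ x))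

id≈·⁻¹ : ∀ {n} (x : Perm n) → id ≈ x · x ⁻¹
id≈·⁻¹ x i = sym (inverseʳ x)

module Cosets {n : ℕ} {G N : PSet n}
              (G-group : IsPermGroup G) (N◁G : IsNormalSubgroup N G) where
  private
    module N = IsPermGroup (proj₁ (proj₁ N◁G))

  -- A record rather than N (x ⁻¹ · y) itself, so that x and y can be inferred.
  infix 4 _∼_
  record _∼_ (x y : Perm n) : Set where
    constructor ⟦_⟧
    field unwrap : N (x ⁻¹ · y)
  open _∼_ public

  ≈⇒∼ : ∀ {x y} → x ≈ y → x ∼ y
  ≈⇒∼ {x} {y} x≈y = ⟦ N.resp _ _ (≈⇒id≈⁻¹· {x = x} {y} x≈y) N.hasId ⟧

  ∼-refl : ∀ {x} → x ∼ x
  ∼-refl = ≈⇒∼ (λ _ → refl)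

  ∼-sym : ∀ {x y} → x ∼ y → y ∼ x
  ∼-sym ⟦ x∼y ⟧ = ⟦ N.resp _ _ (λ _ → refl) (N.inv _ x∼y) ⟧

  ∼-trans : ∀ {x y z} → x ∼ y → y ∼ z → x ∼ z
  ∼-trans {x} {y} ⟦ x∼y ⟧ ⟦ y∼z ⟧ =
    ⟦ N.resp _ _ (λ _ → cong (x ⟨$⟩ˡ_) (inverseʳ y)) (N.mul _ _ x∼y y∼z) ⟧

  module ∼-Reasoning = SingleRelReasoning _∼_ ∼-refl ∼-trans

  ·-cancelˡ-∼ : ∀ z {x y} → z · x ∼ z · y → x ∼ y
  ·-cancelˡ-∼ z {x} ⟦ zx∼zy ⟧ = ⟦ N.resp _ _ (λ _ → cong (x ⟨$⟩ˡ_) (inverseˡ z)) zx∼zy ⟧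

  ·-congˡ-∼ : ∀ z {x y} → x ∼ y → z · x ∼ z · y
  ·-congˡ-∼ z {x} ⟦ x∼y ⟧ = ⟦ N.resp _ _ (λ _ → cong (x ⟨$⟩ˡ_) (sym (inverseˡ z))) x∼y ⟧

  -- Right multiplication respects left cosets only because N is normal.
  ·-congʳ-∼ : ∀ z {x y} → G z → x ∼ y → x · z ∼ y · z
  ·-congʳ-∼ z Gz ⟦ x∼y ⟧ =
    ⟦ N.resp _ _ (λ _ → refl) (proj₂ N◁G (z ⁻¹) _ (IsPermGroup.inv G-group z Gz) x∼y) ⟧

  ⁻¹-cong-∼ : ∀ {x y} → G x → x ∼ y → x ⁻¹ ∼ y ⁻¹
  ⁻¹-cong-∼ {x} {y} Gx ⟦ x∼y ⟧ =
    ⟦ N.resp _ _ (λ _ → cong (λ k → x ⟨$⟩ʳ (y ⟨$⟩ˡ k)) (inverseʳ x))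
        (proj₂ N◁G x _ Gx (N.inv _ x∼y)) ⟧

  ∈N⇒id∼ : ∀ {u} → N u → id ∼ u
  ∈N⇒id∼ Nu = ⟦ N.resp _ _ (λ _ → refl) Nu ⟧

  ∈N⇒·∼ : ∀ u v → G v → N u → u · v ∼ v
  ∈N⇒·∼ u v Gv Nu = begin
    u · v   ∼⟨ ·-congʳ-∼ v Gv (∼-sym (∈N⇒id∼ {u} Nu)) ⟩
    id · v  ∼⟨ ≈⇒∼ (λ _ → refl) ⟩
    v       ∎
    where open ∼-Reasoning

module LiftedQuotientIso {n m : ℕ} {A NA : PSet n} {B NB : PSet m} {f : Perm n → Perm m}
  (A-group : IsPermGroup A) (B-group : IsPermGroup B)
  (NA◁A : IsNormalSubgroup NA A) (NB◁B : IsNormalSubgroup NB B)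
  (φ : IsQuotientIso A NA B NB f) where

  open IsQuotientIso φ
  private
    module A = IsPermGroup A-group
    module B = IsPermGroup B-group
    module A/NA = Cosets A-group NA◁A
  open Cosets B-group NB◁B
  open ∼-Reasoning

  f-cong-∼ : ∀ {a a′} → A a → A a′ → a A/NA.∼ a′ → f a ∼ f a′
  f-cong-∼ Aa Aa′ ⟦ a∼a′ ⟧ = ⟦ wellDef _ _ Aa Aa′ a∼a′ ⟧

  f-cong : ∀ {a a′} → A a → A a′ → a ≈ a′ → f a ∼ f a′
  f-cong Aa Aa′ a≈a′ = f-cong-∼ Aa Aa′ (A/NA.≈⇒∼ a≈a′)

  f-· : ∀ {a a′} → A a → A a′ → f (a · a′) ∼ f a · f a′
  f-· Aa Aa′ = ⟦ hom _ _ Aa Aa′ ⟧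

  f-id : f id ∼ id
  f-id = ∼-sym (·-cancelˡ-∼ (f id) (begin
    f id · id       ∼⟨ ≈⇒∼ (λ _ → refl) ⟩
    f id            ∼⟨ f-cong A.hasId Aid·id (λ _ → refl) ⟩
    f (id · id)     ∼⟨ f-· A.hasId A.hasId ⟩
    f id · f id     ∎))
    where Aid·id = A.mul id id A.hasId A.hasId

  f-⁻¹ : ∀ {a} → A a → f (a ⁻¹) ∼ f a ⁻¹
  f-⁻¹ {a} Aa = ·-cancelˡ-∼ (f a) (begin
    f a · f (a ⁻¹)  ∼⟨ ∼-sym (f-· Aa Aa⁻¹) ⟩
    f (a · a ⁻¹)    ∼⟨ f-cong (A.mul a (a ⁻¹) Aa Aa⁻¹) A.hasId (λ _ → inverseʳ a) ⟩
    f id            ∼⟨ f-id ⟩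
    id              ∼⟨ ≈⇒∼ (id≈·⁻¹ (f a)) ⟩
    f a · f a ⁻¹    ∎)
    where Aa⁻¹ = A.inv a Aa

  fibre-∼ : ∀ a b → NB (f a ⁻¹ · b) → f a ∼ b
  fibre-∼ a b = ⟦_⟧

  fibreProduct-isPairGroup : ∀ {M} → IsSubgroup M A → IsPairGroup (fibreProduct M B NB f)
  fibreProduct-isPairGroup {M} (M-group , M⊆A) = record
    { resp  = λ { a b a′ b′ a≈a′ b≈b′ (Ma , Bb , fa∼b) →
        let Ma′ = M.resp a a′ a≈a′ Ma in
        Ma′ , B.resp b b′ b≈b′ Bb , unwrap (begin
          f a′  ∼⟨ f-cong (M⊆A a′ Ma′) (M⊆A a Ma) (λ i → sym (a≈a′ i)) ⟩
          f a   ∼⟨ fibre-∼ a b fa∼b ⟩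
          b     ∼⟨ ≈⇒∼ b≈b′ ⟩
          b′    ∎) }
    ; hasId = M.hasId , B.hasId , unwrap f-id
    ; mul   = λ { a b a′ b′ (Ma , Bb , fa∼b) (Ma′ , Bb′ , fa′∼b′) →
        M.mul a a′ Ma Ma′ , B.mul b b′ Bb Bb′ , unwrap (begin
          f (a · a′)   ∼⟨ f-· (M⊆A a Ma) (M⊆A a′ Ma′) ⟩
          f a · f a′   ∼⟨ ·-congʳ-∼ (f a′) (into a′ (M⊆A a′ Ma′)) (fibre-∼ a b fa∼b) ⟩
          b · f a′     ∼⟨ ·-congˡ-∼ b (fibre-∼ a′ b′ fa′∼b′) ⟩
          b · b′       ∎) }
    ; inv   = λ { a b (Ma , Bb , fa∼b) →
        M.inv a Ma , B.inv b Bb , unwrap (begin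
          f (a ⁻¹)  ∼⟨ f-⁻¹ (M⊆A a Ma) ⟩
          f a ⁻¹    ∼⟨ ⁻¹-cong-∼ (into a (M⊆A a Ma)) (fibre-∼ a b fa∼b) ⟩
          b ⁻¹      ∎) }
    }
    where module M = IsPermGroup M-group

  fibreProduct-isProperPairSubgroup : ∀ {M} → IsProperSubgroup M A →
    IsProperPairSubgroup (fibreProduct M B NB f) (fibreProduct A B NB f)
  fibreProduct-isProperPairSubgroup (M≤A@(_ , M⊆A) , g , Ag , g∉M) =
    fibreProduct-isPairGroup M≤A ,
    (λ (a , b) (Ma , Bb , fa∼b) → M⊆A a Ma , Bb , fa∼b) ,
    (g , f g) , (Ag , into g Ag , unwrap (∼-refl {f g})) , λ (Mg , _) → g∉M Mg

  fibreProduct-isTwoOrbitTransitive : ∀ {M} → M ⊆ A → IsTransitive M →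
    ProductCovers NA M A → IsTransitive B →
    IsTwoOrbitTransitive (fibreProduct M B NB f)
  fibreProduct-isTwoOrbitTransitive {M} M⊆A M-transitive NAM≡A B-transitive =
    transitive₁ , transitive₂
    where
    transitive₁ : ∀ x y → Σ (Perm n × Perm m) λ { (a , b) →
                    fibreProduct M B NB f (a , b) × a ⟨$⟩ʳ x ≡ y }
    transitive₁ x y with M-transitive x y
    ... | a , Ma , ax≡y = (a , f a) , (Ma , into a (M⊆A a Ma) , unwrap (∼-refl {f a})) , ax≡y

    transitive₂ : ∀ x y → Σ (Perm n × Perm m) λ { (a , b) →
                    fibreProduct M B NB f (a , b) × b ⟨$⟩ʳ x ≡ y }
    transitive₂ x y with B-transitive x y
    ... | b , Bb , bx≡y with surjective b Bb
    ... | a , Aa , fa∼b with NAM≡A a Aa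
    ... | u , v , NAu , Mv , a≈u·v = (v , b) , (Mv , Bb , unwrap fv∼b) , bx≡y
      where
      Av = M⊆A v Mv
      v∼a : v A/NA.∼ a
      v∼a = A/NA.∼-sym (A/NA.∼-trans (A/NA.≈⇒∼ a≈u·v) (A/NA.∈N⇒·∼ u v Av NAu))
      fv∼b : f v ∼ b
      fv∼b = ∼-trans (f-cong-∼ Av Aa v∼a) (fibre-∼ a b fa∼b)

mainTheorem1 : (n m : ℕ) (A NA : PSet n) (B NB : PSet m) (f : Perm n → Perm m) →
    IsPermGroup A → IsTransitive A →
    IsPermGroup B → IsTransitive B →
    IsNormalSubgroup NA A → IsNormalSubgroup NB B →
    IsQuotientIso A NA B NB f →
    NotEssentialKernel NA A →
    NotMinimal (fibreProduct A B NB f)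
mainTheorem1 n m A NA B NB f A-group _ B-group B-transitive NA◁A NB◁B φ
  (M , M<A@((_ , M⊆A) , _) , M-transitive , NAM≡A) =
  fibreProduct M B NB f ,
  fibreProduct-isProperPairSubgroup M<A ,
  fibreProduct-isTwoOrbitTransitive M⊆A M-transitive NAM≡A B-transitive
  where open LiftedQuotientIso A-group B-group NA◁A NB◁B φ
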